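{- Fix an integer $b>4$. Define $d(0,2)=2$, $d(1,2)=b$, and $d(\delta,2)=b\,(d(\delta-1,2)-d(\delta-2,2))$ for $\delta\ge2$. Then for every integer $h\ge3$, $\big(\frac b2\big)^h<d(h,2)\le b^h$. -}

module Defs where

open import Data.Nat using (ℕ; zero; suc)
open import Data.Integer using (ℤ; _-_; _*_; +_)
import Data.Rational as ℚ
open ℚ using (ℚ)

d₂ : ℤ → ℕ → ℤ
d₂ b zero = + 2
d₂ b (suc zero) = b
d₂ b (suc (suc δ)) = b * (d₂ b (suc δ) - d₂ b δ)

infixr 8 _^ℚ_
_^ℚ_ : ℚ → ℕ → ℚ
q ^ℚ zero = ℚ.1ℚ
q ^ℚ suc n = q ℚ.* (q ^ℚ n)

-- As long as 2 d(k) ≤ d(k+1), the difference d(k+1) − d(k) is at least d(k+1)/2, so the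
-- recurrence gives b d(k+1) ≤ 2 d(k+2), and for b ≥ 4 this keeps 2 d(k+1) ≤ d(k+2).
-- Iterating the ratio bound from d(0) = 2 > 1 gives b^h < 2^h d(h), i.e. (b/2)^h < d(h);
-- and since d(k) ≥ 0 the recurrence gives d(k+2) ≤ b d(k+1), so d(h) ≤ b^h from d(1) = b.
-- Neither bound needs more than b ≥ 4 and h ≥ 1.
module Submission where

open import Defs
open import Data.Nat using (ℕ; zero; suc; z≤n; s≤s)
import Data.Nat as ℕ
import Data.Nat.Properties as ℕP
open import Data.Integer using (ℤ; +_; _^_; _*_; _-_; +<+)
import Data.Integer as ℤ
import Data.Integer.Properties as ℤP
import Data.Rational as ℚ
import Data.Rational.Properties as ℚP
import Data.Rational.Unnormalised as ℚᵘ
import Data.Rational.Unnormalised.Properties as ℚᵘP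
open import Data.Product using (_×_; _,_; proj₁; proj₂)
open import Relation.Binary.PropositionalEquality using (_≡_; refl; sym; cong; subst)
open import Data.Integer.Tactic.RingSolver using (solve-∀)

i≤2*i : ∀ {i} → + 0 ℤ.≤ i → i ℤ.≤ + 2 * i
i≤2*i {i} 0≤i = subst (i ℤ.≤_) (double i) (ℤP.i≤i+j i i {{ℤ.nonNegative 0≤i}})
  where
  double : ∀ i → i ℤ.+ i ≡ + 2 * i
  double = solve-∀

2*i≤j⇒j≤2*[j-i] : ∀ {i j} → + 2 * i ℤ.≤ j → j ℤ.≤ + 2 * (j - i)
2*i≤j⇒j≤2*[j-i] {i} {j} 2i≤j =
  ℤP.0≤i-j⇒j≤i (subst (+ 0 ℤ.≤_) (rearrange i j) (ℤP.i≤j⇒0≤j-i 2i≤j))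
  where
  rearrange : ∀ i j → j - + 2 * i ≡ + 2 * (j - i) - j
  rearrange = solve-∀

module _ {b : ℤ} (4≤b : + 4 ℤ.≤ b) where

  private
    0<b : + 0 ℤ.< b
    0<b = ℤP.<-≤-trans (+<+ (s≤s z≤n)) 4≤b

    0≤b : + 0 ℤ.≤ b
    0≤b = ℤP.<⇒≤ 0<b

    b*-mono-≤ : ∀ {i j} → i ℤ.≤ j → b * i ℤ.≤ b * j
    b*-mono-≤ = ℤP.*-monoˡ-≤-nonNeg b {{ℤ.nonNegative 0≤b}}

  d₂-pos-doubling : ∀ k → + 0 ℤ.< d₂ b k × + 2 * d₂ b k ℤ.≤ d₂ b (suc k)
  d₂-pos-doubling zero    = +<+ (s≤s z≤n) , 4≤b
  d₂-pos-doubling (suc k) with d₂-pos-doubling k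
  ... | 0<x , 2x≤y = ℤP.<-≤-trans 0<x x≤y , 2y≤b[y-x]
    where
    x y : ℤ
    x = d₂ b k
    y = d₂ b (suc k)
    x≤y : x ℤ.≤ y
    x≤y = ℤP.≤-trans (i≤2*i (ℤP.<⇒≤ 0<x)) 2x≤y
    2y≤b[y-x] : + 2 * y ℤ.≤ b * (y - x)
    2y≤b[y-x] = begin
      + 2 * y               ≤⟨ ℤP.*-monoˡ-≤-nonNeg (+ 2) (2*i≤j⇒j≤2*[j-i] 2x≤y) ⟩
      + 2 * (+ 2 * (y - x)) ≡⟨ quadruple (y - x) ⟩
      + 4 * (y - x)         ≤⟨ ℤP.*-monoʳ-≤-nonNeg (y - x) {{ℤ.nonNegative (ℤP.i≤j⇒0≤j-i x≤y)}} 4≤b ⟩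
      b * (y - x)           ∎
      where
      open ℤP.≤-Reasoning
      quadruple : ∀ z → + 2 * (+ 2 * z) ≡ + 4 * z
      quadruple = solve-∀

  d₂-nonNeg : ∀ k → + 0 ℤ.≤ d₂ b k
  d₂-nonNeg k = ℤP.<⇒≤ (proj₁ (d₂-pos-doubling k))

  b*d₂≤2*d₂-suc : ∀ k → b * d₂ b k ℤ.≤ + 2 * d₂ b (suc k)
  b*d₂≤2*d₂-suc zero    = ℤP.≤-reflexive (ℤP.*-comm b (+ 2))
  b*d₂≤2*d₂-suc (suc k) = begin
    b * y               ≤⟨ b*-mono-≤ (2*i≤j⇒j≤2*[j-i] (proj₂ (d₂-pos-doubling k))) ⟩
    b * (+ 2 * (y - x)) ≡⟨ swap b (y - x) ⟩
    + 2 * (b * (y - x)) ∎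
    where
    open ℤP.≤-Reasoning
    x y : ℤ
    x = d₂ b k
    y = d₂ b (suc k)
    swap : ∀ b z → b * (+ 2 * z) ≡ + 2 * (b * z)
    swap = solve-∀

  d₂[1+k]≤b^[1+k] : ∀ k → d₂ b (suc k) ℤ.≤ b ^ suc k
  d₂[1+k]≤b^[1+k] zero    = ℤP.≤-reflexive (sym (ℤP.*-identityʳ b))
  d₂[1+k]≤b^[1+k] (suc k) = b*-mono-≤ (ℤP.≤-trans y-x≤y (d₂[1+k]≤b^[1+k] k))
    where
    y-x≤y : d₂ b (suc k) - d₂ b k ℤ.≤ d₂ b (suc k)
    y-x≤y = ℤP.i-j≤i _ _ {{ℤ.nonNegative (d₂-nonNeg k)}}

  b^h<d₂[h]*2^h : ∀ h → b ^ h ℤ.< d₂ b h * + (2 ℕ.^ h)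
  b^h<d₂[h]*2^h zero    = +<+ (s≤s (s≤s z≤n))
  b^h<d₂[h]*2^h (suc h) = begin-strict
    b * b ^ h           <⟨ ℤP.*-monoˡ-<-pos b {{ℤ.positive 0<b}} (b^h<d₂[h]*2^h h) ⟩
    b * (x * t)         ≡⟨ ℤP.*-assoc b x t ⟨
    (b * x) * t         ≤⟨ ℤP.*-monoʳ-≤-nonNeg t (b*d₂≤2*d₂-suc h) ⟩
    (+ 2 * y) * t       ≡⟨ regroup y t ⟩
    y * (+ 2 * t)       ≡⟨ cong (y *_) (ℤP.pos-* 2 (2 ℕ.^ h)) ⟨
    y * + (2 ℕ.^ suc h) ∎
    where
    open ℤP.≤-Reasoning
    x y t : ℤ
    x = d₂ b h
    y = d₂ b (suc h)
    t = + (2 ℕ.^ h)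
    regroup : ∀ y t → (+ 2 * y) * t ≡ y * (+ 2 * t)
    regroup = solve-∀

toℚᵘ-/ : ∀ i n .{{_ : ℕ.NonZero n}} → ℚ.toℚᵘ (i ℚ./ n) ℚᵘ.≃ i ℚᵘ./ n
toℚᵘ-/ i (suc n) = ℚP.toℚᵘ-fromℚᵘ (i ℚᵘ./ suc n)

/-*-/ : ∀ i j m n .{{_ : ℕ.NonZero m}} .{{_ : ℕ.NonZero n}} →
        (i ℚᵘ./ m) ℚᵘ.* (j ℚᵘ./ n) ≡ ((i * j) ℚᵘ./ (m ℕ.* n)) {{ℕP.m*n≢0 m n}}
/-*-/ i j (suc m) (suc n) = refl

toℚᵘ-/-^ℚ : ∀ i n h .{{_ : ℕ.NonZero n}} →
            ℚ.toℚᵘ ((i ℚ./ n) ^ℚ h) ℚᵘ.≃ ((i ^ h) ℚᵘ./ (n ℕ.^ h)) {{ℕP.m^n≢0 n h}}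
toℚᵘ-/-^ℚ i n zero    = ℚᵘP.≃-refl
toℚᵘ-/-^ℚ i n (suc h) = begin-equality
  ℚ.toℚᵘ (q ℚ.* q ^ℚ h)                                     ≃⟨ ℚP.toℚᵘ-homo-* q (q ^ℚ h) ⟩
  ℚ.toℚᵘ q ℚᵘ.* ℚ.toℚᵘ (q ^ℚ h)                              ≃⟨ ℚᵘP.*-cong (toℚᵘ-/ i n) (toℚᵘ-/-^ℚ i n h) ⟩
  (i ℚᵘ./ n) ℚᵘ.* ((i ^ h) ℚᵘ./ (n ℕ.^ h)) {{ℕP.m^n≢0 n h}} ≡⟨ /-*-/ i (i ^ h) n (n ℕ.^ h) {{_}} {{ℕP.m^n≢0 n h}} ⟩
  ((i ^ suc h) ℚᵘ./ (n ℕ.^ suc h)) {{ℕP.m^n≢0 n (suc h)}}   ∎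
  where
  open ℚᵘP.≤-Reasoning
  q : ℚ.ℚ
  q = i ℚ./ n

/-<-/ : ∀ i j m n .{{_ : ℕ.NonZero m}} .{{_ : ℕ.NonZero n}} →
        i * + n ℤ.< j * + m → i ℚᵘ./ m ℚᵘ.< j ℚᵘ./ n
/-<-/ i j (suc m) (suc n) = ℚᵘ.*<*

[i/n]^h<j⇐i^h<j*n^h : ∀ i j n h .{{_ : ℕ.NonZero n}} →
                       i ^ h ℤ.< j * + (n ℕ.^ h) → (i ℚ./ n) ^ℚ h ℚ.< j ℚ./ 1
[i/n]^h<j⇐i^h<j*n^h i j n h i^h<j*n^h = ℚP.toℚᵘ-cancel-< (begin-strict
  ℚ.toℚᵘ ((i ℚ./ n) ^ℚ h)                   ≃⟨ toℚᵘ-/-^ℚ i n h ⟩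
  ((i ^ h) ℚᵘ./ (n ℕ.^ h)) {{ℕP.m^n≢0 n h}} <⟨ /-<-/ (i ^ h) j (n ℕ.^ h) 1 {{ℕP.m^n≢0 n h}} i^h*1<j*n^h ⟩
  j ℚᵘ./ 1                                   ≃⟨ toℚᵘ-/ j 1 ⟨
  ℚ.toℚᵘ (j ℚ./ 1)                           ∎)
  where
  open ℚᵘP.≤-Reasoning
  i^h*1<j*n^h : i ^ h * + 1 ℤ.< j * + (n ℕ.^ h)
  i^h*1<j*n^h = subst (λ k → k ℤ.< j * + (n ℕ.^ h)) (sym (ℤP.*-identityʳ (i ^ h))) i^h<j*n^h

open import Data.Nat using (_≤_)

corollary5 : (b : ℤ) → + 4 ℤ.< b → (h : ℕ) → 3 ≤ h →
    (((b ℚ./ 2) ^ℚ h) ℚ.< (d₂ b h ℚ./ 1)) × (d₂ b h ℤ.≤ (b ^ h))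
corollary5 b 4<b h@(suc k) _ =
  [i/n]^h<j⇐i^h<j*n^h b (d₂ b h) 2 h (b^h<d₂[h]*2^h 4≤b h) , d₂[1+k]≤b^[1+k] 4≤b k
  where
  4≤b : + 4 ℤ.≤ b
  4≤b = ℤP.<⇒≤ 4<b
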